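{- Let $G$ and $H$ be finite simple graphs without isolated vertices, of orders $n$ and $m$ respectively. Then \[ \gamma_{2t}(G\Box H)\ge \tfrac{3}{2}\min\{n,m\}. \]
   Context: The Cartesian product $G\Box H$ has vertex set $V(G)\times V(H)$, with $(u_1,v_1)\sim(u_2,v_2)$ iff either $u_1=u_2$ and $v_1\sim v_2$ in $H$, or $v_1=v_2$ and $u_1\sim u_2$ in $G$. A set $S$ of vertices of a graph is total $2$-dominating if every vertex of the graph is adjacent to at least two vertices of $S$; $\gamma_{2t}$ denotes the minimum cardinality of such a set. -}

module Defs where

open import Data.Nat using (ℕ; _+_)
open import Data.Fin using (Fin)
open import Data.Bool using (Bool; true; false; if_then_else_)
open import Data.Product using (_×_; _,_; ∃; ∃-syntax; proj₁; proj₂)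
open import Data.List using (List; allFin; map; concat)
open import Data.Nat.ListAction using (sum)
open import Relation.Binary.PropositionalEquality using (_≡_)
open import Relation.Nullary using (¬_)
open import Level using (0ℓ)

record Graph (n : ℕ) : Set₁ where
  field
    Adj   : Fin n → Fin n → Set
    sym   : ∀ {u v} → Adj u v → Adj v u
    irrefl : ∀ {u} → ¬ Adj u u
open Graph public

NoIsolated : ∀ {n} → Graph n → Set
NoIsolated {n} G = ∀ (v : Fin n) → ∃[ u ] Adj G v u

data BoxAdj {n m} (G : Graph n) (H : Graph m) : Fin n × Fin m → Fin n × Fin m → Set where
  inH : ∀ {u v₁ v₂} → Adj H v₁ v₂ → BoxAdj G H (u , v₁) (u , v₂)
  inG : ∀ {u₁ u₂ v} → Adj G u₁ u₂ → BoxAdj G H (u₁ , v) (u₂ , v)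

VSet : ℕ → ℕ → Set
VSet n m = Fin n × Fin m → Bool

card : ∀ {n m} → VSet n m → ℕ
card {n} {m} S =
  sum (concat (map (λ u → map (λ v → if S (u , v) then 1 else 0) (allFin m)) (allFin n)))

Total2Dominating : ∀ {n m} (G : Graph n) (H : Graph m) → VSet n m → Set
Total2Dominating {n} {m} G H S =
  ∀ (x : Fin n × Fin m) → ∃[ y ] ∃[ z ] (¬ y ≡ z × BoxAdj G H x y × BoxAdj G H x z × S y ≡ true × S z ≡ true)

-- Let s be the indicator matrix of S, with row sums r u and column sums c v.
-- The two S-neighbours of (u , v) lie in row u or column v and differ from
-- (u , v), so r u + c v ≥ 2 (1 + s u v). If some row is empty, every column sum
-- is at least 2, so |S| ≥ 2m; likewise for an empty column. Otherwise we
-- discharge: a line with k ≥ 1 marked cells gives ⌈3/k⌉ to each of them, so it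
-- gives away at least 3, while a marked cell has r u + c v ≥ 4 and therefore
-- receives at most 4. Hence 3n + 3m ≤ 4|S|.
module Submission where

open import Defs hiding (sym)
open import Data.Nat using (ℕ; zero; suc; _+_; _*_; _≤_; _<_; _⊓_; _≟_; z≤n; s≤s)
open import Data.Nat.Properties
open import Data.Nat.Tactic.RingSolver using (solve-∀)
open import Data.Fin using (Fin; punchOut) renaming (zero to fzero; suc to fsuc)
open import Data.Fin.Properties using (any?; punchOut-injective)
open import Data.Bool using (true; if_then_else_)
open import Data.Product using (_,_)
open import Data.List using (List; []; _∷_; map; concat; tabulate)
open import Data.List.Properties using (map-tabulate)
import Data.Nat.ListAction as List
open import Data.Nat.ListAction.Properties using (sum-++)
open import Data.Vec.Functional using (Vector; removeAt)
open import Data.Vec.Functional.Properties using (removeAt-punchOut)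
open import Algebra.Properties.Semiring.Sum +-*-semiring
  using (sum; sum-syntax; sum-remove; sum-cong-≗; *-distribˡ-sum; *-distribʳ-sum)
open import Algebra.Properties.CommutativeSemigroup +-commutativeSemigroup using (interchange)
open import Relation.Binary.PropositionalEquality
open import Relation.Nullary using (yes; no)
open import Function using (_∘_; id)

sum-const : ∀ k c → ∑[ i < k ] c ≡ k * c
sum-const zero    c = refl
sum-const (suc k) c = cong (c +_) (sum-const k c)

sum-mono-≤ : ∀ {k} {f g : Vector ℕ k} → (∀ i → f i ≤ g i) → sum f ≤ sum g
sum-mono-≤ {zero}  f≤g = z≤n
sum-mono-≤ {suc k} f≤g = +-mono-≤ (f≤g fzero) (sum-mono-≤ (f≤g ∘ fsuc))

sum-distrib-+ : ∀ {k} (f g : Vector ℕ k) → ∑[ i < k ] (f i + g i) ≡ sum f + sum g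
sum-distrib-+ {zero}  f g = refl
sum-distrib-+ {suc k} f g =
  trans (cong (f fzero + g fzero +_) (sum-distrib-+ (f ∘ fsuc) (g ∘ fsuc)))
        (interchange (f fzero) (g fzero) (sum (f ∘ fsuc)) (sum (g ∘ fsuc)))

sum-swap : ∀ {k l} (t : Fin k → Fin l → ℕ) →
  ∑[ i < k ] ∑[ j < l ] t i j ≡ ∑[ j < l ] ∑[ i < k ] t i j
sum-swap {zero}  {l} t = sym (trans (sum-const l 0) (*-zeroʳ l))
sum-swap {suc k} t =
  trans (cong (sum (t fzero) +_) (sum-swap (t ∘ fsuc)))
        (sym (sum-distrib-+ (t fzero) (λ j → ∑[ i < k ] t (fsuc i) j)))

elem≤sum : ∀ {k} (t : Vector ℕ k) i → t i ≤ sum t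
elem≤sum t fzero    = m≤m+n _ _
elem≤sum t (fsuc i) = ≤-trans (elem≤sum (t ∘ fsuc) i) (m≤n+m _ _)

pair≤sum : ∀ {k} (t : Vector ℕ k) {i j} → i ≢ j → t i + t j ≤ sum t
pair≤sum {suc k} t {i} {j} i≢j = begin
  t i + t j                           ≡⟨ cong (t i +_) (removeAt-punchOut t i≢j) ⟨
  t i + removeAt t i (punchOut i≢j)   ≤⟨ +-monoʳ-≤ (t i) (elem≤sum (removeAt t i) _) ⟩
  t i + sum (removeAt t i)            ≡⟨ sum-remove t ⟨
  sum t                               ∎
  where open ≤-Reasoning

triple≤sum : ∀ {k} (t : Vector ℕ k) {i j l} → i ≢ j → i ≢ l → j ≢ l →
  t i + (t j + t l) ≤ sum t
triple≤sum {suc k} t {i} {j} {l} i≢j i≢l j≢l = begin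
  t i + (t j + t l)
    ≡⟨ cong₂ (λ a b → t i + (a + b)) (removeAt-punchOut t i≢j) (removeAt-punchOut t i≢l) ⟨
  t i + (removeAt t i (punchOut i≢j) + removeAt t i (punchOut i≢l))
    ≤⟨ +-monoʳ-≤ (t i) (pair≤sum (removeAt t i) (j≢l ∘ punchOut-injective i≢j i≢l)) ⟩
  t i + sum (removeAt t i)
    ≡⟨ sum-remove t ⟨
  sum t ∎
  where open ≤-Reasoning

+0≤sum : ∀ {k} (t : Vector ℕ k) i → t i + 0 ≤ sum t
+0≤sum t i = subst (_≤ sum t) (sym (+-identityʳ (t i))) (elem≤sum t i)

+1≤sum : ∀ {k} (t : Vector ℕ k) {i j} → i ≢ j → t j ≡ 1 → t i + 1 ≤ sum t
+1≤sum t {i} i≢j tj≡1 = subst (λ a → t i + a ≤ sum t) tj≡1 (pair≤sum t i≢j)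

+2≤sum : ∀ {k} (t : Vector ℕ k) {i j l} → i ≢ j → i ≢ l → j ≢ l → t j ≡ 1 → t l ≡ 1 →
  t i + 2 ≤ sum t
+2≤sum t {i} i≢j i≢l j≢l tj≡1 tl≡1 =
  subst₂ (λ a b → t i + (a + b) ≤ sum t) tj≡1 tl≡1 (triple≤sum t i≢j i≢l j≢l)

sum-concat : (xss : List (List ℕ)) → List.sum (concat xss) ≡ List.sum (map List.sum xss)
sum-concat []         = refl
sum-concat (xs ∷ xss) = trans (sum-++ xs (concat xss)) (cong (List.sum xs +_) (sum-concat xss))

sum-tabulate : ∀ {k} (t : Vector ℕ k) → List.sum (tabulate t) ≡ sum t
sum-tabulate {zero}  t = refl
sum-tabulate {suc k} t = cong (t fzero +_) (sum-tabulate (t ∘ fsuc))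

-- weight k = ⌈3/k⌉ for k ≥ 1; the value at 0 is never used.
weight : ℕ → ℕ
weight 0                   = 3
weight 1                   = 3
weight 2                   = 2
weight (suc (suc (suc _))) = 1

weight≤3 : ∀ k → weight k ≤ 3
weight≤3 0                   = ≤-refl
weight≤3 1                   = ≤-refl
weight≤3 2                   = m≤n+m 2 1
weight≤3 (suc (suc (suc _))) = m≤n+m 1 2

3≤*weight : ∀ {k} → 0 < k → 3 ≤ k * weight k
3≤*weight {1}                   _ = ≤-refl
3≤*weight {2}                   _ = m≤n+m 3 1
3≤*weight {suc (suc (suc k))}   _ = subst (3 ≤_) (sym (*-identityʳ (3 + k))) (m≤m+n 3 k)

weight+weight≤4 : ∀ r c → 4 ≤ r + c → weight r + weight c ≤ 4
weight+weight≤4 (suc (suc (suc _))) c                   _ = s≤s (weight≤3 c)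
weight+weight≤4 r                   (suc (suc (suc _))) _ = +-monoˡ-≤ 1 (weight≤3 r)
weight+weight≤4 2 2 _ = ≤-refl
weight+weight≤4 0 0 ()
weight+weight≤4 0 1 (s≤s ())
weight+weight≤4 0 2 (s≤s (s≤s ()))
weight+weight≤4 1 0 (s≤s ())
weight+weight≤4 1 1 (s≤s (s≤s ()))
weight+weight≤4 1 2 (s≤s (s≤s (s≤s ())))
weight+weight≤4 2 0 (s≤s (s≤s ()))
weight+weight≤4 2 1 (s≤s (s≤s (s≤s ())))

weighted-cell≤ : ∀ x r c → 2 * suc x ≤ r + c → x * weight r + x * weight c ≤ 4 * x
weighted-cell≤ zero      r c _ = z≤n
weighted-cell≤ x@(suc _) r c h = begin
  x * weight r + x * weight c  ≡⟨ *-distribˡ-+ x (weight r) (weight c) ⟨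
  x * (weight r + weight c)    ≤⟨ *-monoʳ-≤ x (weight+weight≤4 r c 4≤r+c) ⟩
  x * 4                        ≡⟨ *-comm x 4 ⟩
  4 * x                        ∎
  where
  open ≤-Reasoning
  4≤r+c : 4 ≤ r + c
  4≤r+c = ≤-trans (*-monoʳ-≤ 2 (s≤s (s≤s z≤n))) h

3*≤2*-from-2*≤ : ∀ {x k t} → x ≤ k → 2 * k ≤ t → 3 * x ≤ 2 * t
3*≤2*-from-2*≤ {x} {k} {t} x≤k 2k≤t = begin
  3 * x        ≤⟨ *-monoʳ-≤ 3 x≤k ⟩
  3 * k        ≤⟨ *-monoˡ-≤ k (n≤1+n 3) ⟩
  4 * k        ≡⟨ *-assoc 2 2 k ⟩
  2 * (2 * k)  ≤⟨ *-monoʳ-≤ 2 2k≤t ⟩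
  2 * t        ∎
  where open ≤-Reasoning

cross-from : ∀ {x a b r c} → x + a ≤ r → x + b ≤ c → a + b ≡ 2 → 2 * suc x ≤ r + c
cross-from {x} {a} {b} {r} {c} x+a≤r x+b≤c a+b≡2 = begin
  2 * suc x          ≡⟨ double-suc x ⟩
  (x + x) + 2        ≡⟨ cong (x + x +_) a+b≡2 ⟨
  (x + x) + (a + b)  ≡⟨ interchange x a x b ⟨
  (x + a) + (x + b)  ≤⟨ +-mono-≤ x+a≤r x+b≤c ⟩
  r + c              ∎
  where
  open ≤-Reasoning
  double-suc : ∀ x → 2 * suc x ≡ (x + x) + 2
  double-suc = solve-∀

module CrossCount {n m} (s : Fin n → Fin m → ℕ) where

  rowSum : Fin n → ℕ
  rowSum u = ∑[ v < m ] s u v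

  colSum : Fin m → ℕ
  colSum v = ∑[ u < n ] s u v

  total : ℕ
  total = ∑[ u < n ] rowSum u

  total-by-columns : total ≡ ∑[ v < m ] colSum v
  total-by-columns = sum-swap s

  module _ (cross : ∀ u v → 2 * suc (s u v) ≤ rowSum u + colSum v) where

    empty-row⇒ : ∀ {u} → rowSum u ≡ 0 → 2 * m ≤ total
    empty-row⇒ {u} row≡0 = begin
      2 * m                  ≡⟨ trans (sum-const m 2) (*-comm m 2) ⟨
      ∑[ v < m ] 2           ≤⟨ sum-mono-≤ 2≤colSum ⟩
      ∑[ v < m ] colSum v    ≡⟨ total-by-columns ⟨
      total                  ∎
      where
      open ≤-Reasoning
      2≤colSum : ∀ v → 2 ≤ colSum v
      2≤colSum v = ≤-trans (*-monoʳ-≤ 2 (s≤s z≤n))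
        (subst (λ r → 2 * suc (s u v) ≤ r + colSum v) row≡0 (cross u v))

    empty-column⇒ : ∀ {v} → colSum v ≡ 0 → 2 * n ≤ total
    empty-column⇒ {v} col≡0 = begin
      2 * n                  ≡⟨ trans (sum-const n 2) (*-comm n 2) ⟨
      ∑[ u < n ] 2           ≤⟨ sum-mono-≤ 2≤rowSum ⟩
      total                  ∎
      where
      open ≤-Reasoning
      2≤rowSum : ∀ u → 2 ≤ rowSum u
      2≤rowSum u = ≤-trans (*-monoʳ-≤ 2 (s≤s z≤n))
        (subst (λ c → 2 * suc (s u v) ≤ c) (trans (cong (rowSum u +_) col≡0) (+-identityʳ _))
          (cross u v))

    weighted-count : (∀ u → 0 < rowSum u) → (∀ v → 0 < colSum v) → 3 * n + 3 * m ≤ 4 * total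
    weighted-count rows>0 cols>0 = begin
      3 * n + 3 * m
        ≡⟨ cong₂ _+_ (trans (sum-const n 3) (*-comm n 3)) (trans (sum-const m 3) (*-comm m 3)) ⟨
      ∑[ u < n ] 3 + ∑[ v < m ] 3
        ≤⟨ +-mono-≤ (sum-mono-≤ (3≤*weight ∘ rows>0)) (sum-mono-≤ (3≤*weight ∘ cols>0)) ⟩
      ∑[ u < n ] (rowSum u * weight (rowSum u)) + ∑[ v < m ] (colSum v * weight (colSum v))
        ≡⟨ cong₂ _+_ rows-pay cols-pay ⟩
      ∑[ u < n ] ∑[ v < m ] (s u v * weight (rowSum u))
        + ∑[ u < n ] ∑[ v < m ] (s u v * weight (colSum v))
        ≡⟨ trans (sum-cong-≗ {n} λ u → sum-distrib-+ {m} _ _) (sum-distrib-+ {n} _ _) ⟨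
      ∑[ u < n ] ∑[ v < m ] (s u v * weight (rowSum u) + s u v * weight (colSum v))
        ≤⟨ sum-mono-≤ (λ u → sum-mono-≤ λ v → weighted-cell≤ (s u v) _ _ (cross u v)) ⟩
      ∑[ u < n ] ∑[ v < m ] (4 * s u v)
        ≡⟨ trans (*-distribˡ-sum 4 rowSum) (sum-cong-≗ λ u → *-distribˡ-sum 4 (s u)) ⟨
      4 * total ∎
      where
      open ≤-Reasoning
      rows-pay : ∑[ u < n ] (rowSum u * weight (rowSum u))
               ≡ ∑[ u < n ] ∑[ v < m ] (s u v * weight (rowSum u))
      rows-pay = sum-cong-≗ λ u → *-distribʳ-sum (weight (rowSum u)) (s u)
      cols-pay : ∑[ v < m ] (colSum v * weight (colSum v))
               ≡ ∑[ u < n ] ∑[ v < m ] (s u v * weight (colSum v))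
      cols-pay = trans (sum-cong-≗ λ v → *-distribʳ-sum (weight (colSum v)) (λ u → s u v))
                       (sym (sum-swap λ u v → s u v * weight (colSum v)))

    3*min≤2*total : 3 * (n ⊓ m) ≤ 2 * total
    3*min≤2*total with any? (λ u → rowSum u ≟ 0) | any? (λ v → colSum v ≟ 0)
    ... | yes (_ , row≡0) | _              = 3*≤2*-from-2*≤ (m⊓n≤n n m) (empty-row⇒ row≡0)
    ... | no _            | yes (_ , col≡0) = 3*≤2*-from-2*≤ (m⊓n≤m n m) (empty-column⇒ col≡0)
    ... | no no-empty-row | no no-empty-col = *-cancelˡ-≤ 2 (begin
      2 * (3 * (n ⊓ m))        ≡⟨ cong (3 * (n ⊓ m) +_) (+-identityʳ _) ⟩
      3 * (n ⊓ m) + 3 * (n ⊓ m) ≤⟨ +-mono-≤ (*-monoʳ-≤ 3 (m⊓n≤m n m)) (*-monoʳ-≤ 3 (m⊓n≤n n m)) ⟩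
      3 * n + 3 * m            ≤⟨ weighted-count (λ u → n≢0⇒n>0 λ e → no-empty-row (u , e))
                                                 (λ v → n≢0⇒n>0 λ e → no-empty-col (v , e)) ⟩
      4 * total                ≡⟨ *-assoc 2 2 total ⟩
      2 * (2 * total)          ∎)
      where open ≤-Reasoning

indicator : ∀ {n m} → VSet n m → Fin n → Fin m → ℕ
indicator S u v = if S (u , v) then 1 else 0

indicator-marked : ∀ {n m} (S : VSet n m) {u v} → S (u , v) ≡ true → indicator S u v ≡ 1
indicator-marked S S[u,v] = cong (if_then 1 else 0) S[u,v]

card≡sum-indicator : ∀ {n m} (S : VSet n m) → card S ≡ ∑[ u < n ] ∑[ v < m ] indicator S u v
card≡sum-indicator {n} {m} S = begin
  card S
    ≡⟨ sum-concat (map row (tabulate id)) ⟩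
  List.sum (map List.sum (map row (tabulate id)))
    ≡⟨ cong (List.sum ∘ map List.sum) (map-tabulate id row) ⟩
  List.sum (map List.sum (tabulate row))
    ≡⟨ cong List.sum (map-tabulate row List.sum) ⟩
  List.sum (tabulate (List.sum ∘ row))
    ≡⟨ sum-tabulate (List.sum ∘ row) ⟩
  ∑[ u < n ] List.sum (row u)
    ≡⟨ sum-cong-≗ sum-row ⟩
  ∑[ u < n ] ∑[ v < m ] indicator S u v ∎
  where
  open ≡-Reasoning
  row : Fin n → List ℕ
  row u = map (indicator S u) (tabulate id)
  sum-row : ∀ u → List.sum (row u) ≡ ∑[ v < m ] indicator S u v
  sum-row u = trans (cong List.sum (map-tabulate id (indicator S u))) (sum-tabulate (indicator S u))

adj⇒≢ : ∀ {k} (G : Graph k) {u w} → Adj G u w → u ≢ w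
adj⇒≢ G uw refl = irrefl G uw

module _ {n m} (G : Graph n) (H : Graph m) {S : VSet n m} (dom : Total2Dominating G H S) where
  open CrossCount (indicator S)

  cross-bound : ∀ u v → 2 * suc (indicator S u v) ≤ rowSum u + colSum v
  cross-bound u v with dom (u , v)
  ... | _ , _ , y≢z , inH v~w₁ , inH v~w₂ , y∈S , z∈S =
    cross-from (+2≤sum (indicator S u) (adj⇒≢ H v~w₁) (adj⇒≢ H v~w₂) (y≢z ∘ cong (u ,_))
                  (indicator-marked S y∈S) (indicator-marked S z∈S))
               (+0≤sum (λ w → indicator S w v) u) refl
  ... | _ , _ , _ , inH v~w , inG u~w′ , y∈S , z∈S =
    cross-from (+1≤sum (indicator S u) (adj⇒≢ H v~w) (indicator-marked S y∈S))
               (+1≤sum (λ w → indicator S w v) (adj⇒≢ G u~w′) (indicator-marked S z∈S)) refl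
  ... | _ , _ , _ , inG u~w′ , inH v~w , y∈S , z∈S =
    cross-from (+1≤sum (indicator S u) (adj⇒≢ H v~w) (indicator-marked S z∈S))
               (+1≤sum (λ w → indicator S w v) (adj⇒≢ G u~w′) (indicator-marked S y∈S)) refl
  ... | _ , _ , y≢z , inG u~w₁ , inG u~w₂ , y∈S , z∈S =
    cross-from (+0≤sum (indicator S u) v)
               (+2≤sum (λ w → indicator S w v) (adj⇒≢ G u~w₁) (adj⇒≢ G u~w₂) (y≢z ∘ cong (_, v))
                  (indicator-marked S y∈S) (indicator-marked S z∈S)) refl

corollary2p11 : ∀ {n m} (G : Graph n) (H : Graph m) → NoIsolated G → NoIsolated H →
    (S : VSet n m) → Total2Dominating G H S → 3 * (n ⊓ m) ≤ 2 * card S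
corollary2p11 {n} {m} G H _ _ S dom =
  subst (λ k → 3 * (n ⊓ m) ≤ 2 * k) (sym (card≡sum-indicator S))
    (CrossCount.3*min≤2*total (indicator S) (cross-bound G H dom))
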